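{- Every integer $n$ is the Eliahou number of some numerical semigroup, i.e., there exists a numerical semigroup $S$ with $\mathrm{E}(S)=n$.
   Context: A numerical semigroup is a submonoid of $(\mathbb N,+)$ with finite complement. For a numerical semigroup $S$: conductor $c$ is the smallest integer such that all integers $\ge c$ are in $S$; multiplicity $m$ is its least positive element; $L=\{s\in S: s<c\}$; $P$ is the set of minimal generators; $q=\lceil c/m\rceil$; $\rho=qm-c$; $I_q=\{z\in\mathbb Z: c\le z<c+m\}$; $D_q=I_q\setminus P$. The Eliahou number is $\mathrm{E}(S)=|P\cap L|\,|L|-q\,|D_q|+\rho$. -}

module Defs where

open import Data.Bool using (Bool; true; false; _∧_; not; if_then_else_)
open import Data.Nat using (ℕ; zero; suc; _+_; _*_; _∸_; _≤_; _<_; _≡ᵇ_)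
open import Data.Nat.DivMod using (_/_)
open import Data.Integer using (ℤ; +_) renaming (_+_ to _+ℤ_; _-_ to _-ℤ_)
open import Data.Product using (∃-syntax; _×_)
open import Relation.Binary.PropositionalEquality using (_≡_)

record NumericalSemigroup : Set where
  field
    mem      : ℕ → Bool
    zero∈    : mem 0 ≡ true
    closed   : ∀ a b → mem a ≡ true → mem b ≡ true → mem (a + b) ≡ true
    cofinite : ∃[ N ] (∀ k → N ≤ k → mem k ≡ true)
open NumericalSemigroup public

IsConductor : NumericalSemigroup → ℕ → Set
IsConductor S c =
  (∀ k → c ≤ k → mem S k ≡ true) ×
  (∀ d → (∀ k → d ≤ k → mem S k ≡ true) → c ≤ d)

IsMultiplicity : NumericalSemigroup → ℕ → Set
IsMultiplicity S m =
  (0 < m) × (mem S m ≡ true) × (∀ k → 0 < k → mem S k ≡ true → m ≤ k)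

count : (ℕ → Bool) → ℕ → ℕ → ℕ
count p a zero = 0
count p a (suc len) = (if p a then 1 else 0) + count p (suc a) len

anyIn : (ℕ → Bool) → ℕ → ℕ → Bool
anyIn p a zero = false
anyIn p a (suc len) = if p a then true else anyIn p (suc a) len

-- s is a minimal generator: s ∈ S, s ≠ 0, and s is not a sum a + (s - a)
-- of two nonzero elements of S (i.e. s ∉ (S∖{0}) + (S∖{0})).
isMinGen : NumericalSemigroup → ℕ → Bool
isMinGen S s =
  mem S s ∧ not (s ≡ᵇ 0) ∧
  not (anyIn (λ a → mem S a ∧ mem S (s ∸ a)) 1 (s ∸ 1))

-- ⌈ c / m ⌉ for m > 0 (value at m = 0 irrelevant)
ceilDiv : ℕ → ℕ → ℕ
ceilDiv c zero = 0
ceilDiv c (suc k) = (c + k) / suc k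

-- Eliahou number, given the conductor c and multiplicity m of S:
-- E(S) = |P ∩ L| |L| - q |D_q| + ρ
eliahou : NumericalSemigroup → ℕ → ℕ → ℤ
eliahou S c m =
  (+ (nPL * nL) -ℤ + (q * nD)) +ℤ + ρ
  where
    nL  = count (mem S) 0 c                    -- |L|, L = S ∩ [0, c)
    nPL = count (isMinGen S) 0 c
    q   = ceilDiv c m
    ρ   = q * m ∸ c
    nD  = count (λ z → not (isMinGen S z)) c m -- |D_q|, I_q = [c, c+m)

-- For t = t₀ + 1 and u ≥ 0 let s = t + u + 4, m = 2 + t s and c = (2t − 1) m + (m − u).
-- Writing an integer as k m + 2 + e s + r (row k, block e < t, offset r < s), the semigroup
-- below c consists of the multiples of m and a staircase: the cells with r + e ≤ t in the rows
-- k ≥ 2(t − e) − 1. Adding two cells either carries one block into the next row and stays in the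
-- staircase, or lands in row 2t or later, above c. The minimal generators below c are m,
-- a = m + 2 + t₀ s and a + 1, so |P ∩ L| = 3, while q = 2t and ρ = u. Counting L row by row and
-- the non-generators of I_q block by block gives 3 |L| + t(t − 1)/2 = 2t |D_q|, hence
-- E(S) = u − t(t − 1)/2, and every integer has this form.
module Submission where

open import Algebra.Properties.CommutativeSemigroup using (interchange)
open import Data.Bool using (Bool; true; false; _∧_; _∨_; not; if_then_else_)
open import Data.Bool.Properties using (∧-zeroʳ; ∨-zeroʳ)
open import Data.Empty using (⊥; ⊥-elim)
open import Data.Integer as ℤ using (ℤ; _⊖_)
open import Data.Integer.Properties using ([+m]-[+n]≡m⊖n; +-cancelˡ-⊖; distribˡ-⊖-+-pos)
open import Data.Nat
open import Data.Nat.DivMod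
open import Data.Nat.Divisibility using (divides)
open import Data.Nat.Properties
open import Data.Nat.Tactic.RingSolver using (solve-∀)
open import Data.Product using (∃-syntax; _×_; _,_; proj₁; proj₂)
open import Data.Sum using (_⊎_; inj₁; inj₂)
open import Relation.Nullary using (Dec; yes; no; does; ¬_; contradiction)
open import Relation.Nullary.Decidable using (dec-true; dec-false; map′; _×-dec_; _⊎-dec_)
open import Relation.Binary.PropositionalEquality

open import Defs

does⇒witness : ∀ {P : Set} (d : Dec P) → does d ≡ true → P
does⇒witness (yes p) _ = p

Window : (ℕ → Set) → ℕ → ℕ → Set
Window P a l = ∀ r → r < l → P (a + r)

window-head : ∀ (P : ℕ → Set) {a l} → Window P a (suc l) → P a
window-head P {a} h = subst P (+-identityʳ a) (h 0 z<s)

window-tail : ∀ (P : ℕ → Set) {a l} → Window P a (suc l) → Window P (suc a) l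
window-tail P {a} h r r<l = subst P (+-suc a r) (h (suc r) (s≤s r<l))

count-++ : ∀ p a l₁ l₂ → count p a (l₁ + l₂) ≡ count p a l₁ + count p (a + l₁) l₂
count-++ p a zero l₂ = cong (λ b → count p b l₂) (sym (+-identityʳ a))
count-++ p a (suc l₁) l₂ rewrite count-++ p (suc a) l₁ l₂ | +-suc a l₁ =
  sym (+-assoc (if p a then 1 else 0) (count p (suc a) l₁) _)

count-cong : ∀ p q a l → Window (λ i → p i ≡ q i) a l → count p a l ≡ count q a l
count-cong p q a zero h = refl
count-cong p q a (suc l) h rewrite window-head (λ i → p i ≡ q i) h =
  cong (_ +_) (count-cong p q (suc a) l (window-tail (λ i → p i ≡ q i) h))

count-all : ∀ p a l → Window (λ i → p i ≡ true) a l → count p a l ≡ l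
count-all p a zero h = refl
count-all p a (suc l) h rewrite window-head (λ i → p i ≡ true) h =
  cong suc (count-all p (suc a) l (window-tail (λ i → p i ≡ true) h))

count-none : ∀ p a l → Window (λ i → p i ≡ false) a l → count p a l ≡ 0
count-none p a zero h = refl
count-none p a (suc l) h rewrite window-head (λ i → p i ≡ false) h =
  count-none p (suc a) l (window-tail (λ i → p i ≡ false) h)

count-prefix : ∀ p a w l → Window (λ i → p i ≡ true) a w →
               Window (λ i → p i ≡ false) (a + w) l → count p a (w + l) ≡ w
count-prefix p a w l hits misses
  rewrite count-++ p a w l | count-all p a w hits | count-none p (a + w) l misses = +-identityʳ w

count-next-hit : ∀ p a l₁ l₂ → Window (λ i → p i ≡ false) a l₁ → p (a + l₁) ≡ true →
                 count p a (l₁ + suc l₂) ≡ suc (count p (suc (a + l₁)) l₂)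
count-next-hit p a l₁ l₂ miss hit rewrite count-++ p a l₁ (suc l₂) | count-none p a l₁ miss | hit = refl

anyIn-witness : ∀ p a l r → r < l → p (a + r) ≡ true → anyIn p a l ≡ true
anyIn-witness p a (suc l) zero _ h rewrite +-identityʳ a | h = refl
anyIn-witness p a (suc l) (suc r) r<l h with p a
... | true  = refl
... | false = anyIn-witness p (suc a) l r (≤-pred r<l) (subst (λ i → p i ≡ true) (+-suc a r) h)

anyIn-none : ∀ p a l → Window (λ i → p i ≡ false) a l → anyIn p a l ≡ false
anyIn-none p a zero h = refl
anyIn-none p a (suc l) h rewrite window-head (λ i → p i ≡ false) h =
  anyIn-none p (suc a) l (window-tail (λ i → p i ≡ false) h)

sumBelow : ℕ → (ℕ → ℕ) → ℕ
sumBelow zero    f = 0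
sumBelow (suc n) f = f 0 + sumBelow n (λ i → f (suc i))

sumBelow-cong : ∀ n {f g} → (∀ i → i < n → f i ≡ g i) → sumBelow n f ≡ sumBelow n g
sumBelow-cong zero    h = refl
sumBelow-cong (suc n) h = cong₂ _+_ (h 0 z<s) (sumBelow-cong n (λ i i<n → h (suc i) (s≤s i<n)))

sumBelow-+ : ∀ n f g → sumBelow n (λ i → f i + g i) ≡ sumBelow n f + sumBelow n g
sumBelow-+ zero    f g = refl
sumBelow-+ (suc n) f g rewrite sumBelow-+ n (λ i → f (suc i)) (λ i → g (suc i)) =
  interchange +-commutativeSemigroup (f 0) (g 0) (sumBelow n (λ i → f (suc i))) (sumBelow n (λ i → g (suc i)))

sumBelow-const : ∀ n k → sumBelow n (λ _ → k) ≡ n * k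
sumBelow-const zero    k = refl
sumBelow-const (suc n) k = cong (k +_) (sumBelow-const n k)

sumBelow-++ : ∀ a b f → sumBelow (a + b) f ≡ sumBelow a f + sumBelow b (λ i → f (a + i))
sumBelow-++ zero    b f = refl
sumBelow-++ (suc a) b f rewrite sumBelow-++ a b (λ i → f (suc i)) =
  sym (+-assoc (f 0) (sumBelow a (λ i → f (suc i))) _)

count-rows : ∀ p a n l → count p a (n * l) ≡ sumBelow n (λ k → count p (a + k * l) l)
count-rows p a zero    l = refl
count-rows p a (suc n) l rewrite count-++ p a l (n * l) | count-rows p (a + l) n l | +-identityʳ a =
  cong (count p a l +_) (sumBelow-cong n (λ k _ → cong (λ b → count p b l) (+-assoc a l (k * l))))

[kn+r]%n≡r : ∀ k r n .{{_ : NonZero n}} → r < n → (k * n + r) % n ≡ r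
[kn+r]%n≡r k r n r<n rewrite +-comm (k * n) r = trans ([m+kn]%n≡m%n r k n) (m<n⇒m%n≡m r<n)

[kn+r]/n≡k : ∀ k r n .{{_ : NonZero n}} → r < n → (k * n + r) / n ≡ k
[kn+r]/n≡k k r n r<n rewrite +-comm (k * n) r =
  trans (+-distrib-/-∣ʳ r (divides k refl)) (cong₂ _+_ (m<n⇒m/n≡0 r<n) (m*n/n≡m k n))

module _ (S : NumericalSemigroup) where

  isMinGen-zero : isMinGen S 0 ≡ false
  isMinGen-zero = ∧-zeroʳ (mem S 0)

  isMinGen⇒member : ∀ z → isMinGen S z ≡ true → mem S z ≡ true
  isMinGen⇒member z g with mem S z
  ... | true  = refl
  ... | false = g

  isMinGen-+ : ∀ w y → 0 < w → 0 < y → mem S w ≡ true → mem S y ≡ true → isMinGen S (w + y) ≡ false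
  isMinGen-+ (suc w) (suc y) _ _ hw hy
    rewrite anyIn-witness (λ a → mem S a ∧ mem S (suc w + suc y ∸ a)) 1 (w + suc y) w (m<m+n w z<s)
              (subst (λ v → mem S (suc w) ∧ mem S v ≡ true) (sym (m+n∸m≡n w (suc y))) (cong₂ _∧_ hw hy))
    = ∧-zeroʳ (mem S (suc w + suc y))

  Indecomposable : ℕ → Set
  Indecomposable z = ∀ {w y} → 0 < w → 0 < y → w + y ≡ z → mem S w ≡ true → mem S y ≡ true → ⊥

  isMinGen-indecomposable : ∀ {z} → mem S z ≡ true → 0 < z → Indecomposable z → isMinGen S z ≡ true
  isMinGen-indecomposable {suc z} hz _ indecomposable =
    cong₂ (λ x y → x ∧ not y) hz (anyIn-none (λ a → mem S a ∧ mem S (suc z ∸ a)) 1 z no-split)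
    where
      no-split : Window (λ a → mem S a ∧ mem S (suc z ∸ a) ≡ false) 1 z
      no-split r r<z with mem S (suc r) in hw | mem S (z ∸ r) in hy
      ... | false | _     = refl
      ... | true  | false = refl
      ... | true  | true  = ⊥-elim (indecomposable z<s (m<n⇒0<n∸m r<z) (m+[n∸m]≡n (<⇒≤ (s≤s r<z))) hw hy)

  isMinGen-below-twice-multiplicity : ∀ {m z} → IsMultiplicity S m →
    mem S z ≡ true → 0 < z → z < m + m → isMinGen S z ≡ true
  isMinGen-below-twice-multiplicity {m} (_ , _ , minimal) hz 0<z z<2m = isMinGen-indecomposable hz 0<z
    λ {w} {y} 0<w 0<y w+y≡z hw hy →
      <⇒≱ z<2m (subst (m + m ≤_) w+y≡z (+-mono-≤ (minimal w 0<w hw) (minimal y 0<y hy)))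

-- lit j k is the number of staircase cells in the block of height j = t − e of row k.
lit : ℕ → ℕ → ℕ
lit j k = if does (j + j ≤? k + 1) then suc j else 0

rowLit : ℕ → ℕ → ℕ
rowLit zero    k = 0
rowLit (suc n) k = lit (suc n) k + rowLit n k

sumBelow-lit : ∀ j d → sumBelow (suc j + d + (suc j + d)) (lit (suc j)) ≡ (d + d + 1) * (j + 2)
sumBelow-lit j d = begin
  sumBelow (suc j + d + (suc j + d)) (lit (suc j))
    ≡⟨ cong (λ n → sumBelow n (lit (suc j))) (regroup j d) ⟩
  sumBelow ((j + j + 1) + (d + d + 1)) (lit (suc j))
    ≡⟨ sumBelow-++ (j + j + 1) (d + d + 1) (lit (suc j)) ⟩
  sumBelow (j + j + 1) (lit (suc j)) + sumBelow (d + d + 1) (λ i → lit (suc j) (j + j + 1 + i))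
    ≡⟨ cong₂ _+_ (trans (sumBelow-cong (j + j + 1) dark) (sumBelow-const (j + j + 1) 0))
                 (trans (sumBelow-cong (d + d + 1) bright) (sumBelow-const (d + d + 1) (j + 2))) ⟩
  (j + j + 1) * 0 + (d + d + 1) * (j + 2)
    ≡⟨ cong (_+ (d + d + 1) * (j + 2)) (*-zeroʳ (j + j + 1)) ⟩
  (d + d + 1) * (j + 2) ∎
  where
    open ≡-Reasoning
    regroup : ∀ j d → suc j + d + (suc j + d) ≡ (j + j + 1) + (d + d + 1)
    regroup = solve-∀
    twice-suc : ∀ j → j + j + 1 + 1 ≡ suc j + suc j
    twice-suc = solve-∀
    dark : ∀ k → k < j + j + 1 → lit (suc j) k ≡ 0
    dark k k< rewrite dec-false (suc j + suc j ≤? k + 1)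
      (<⇒≱ (subst (k + 1 <_) (twice-suc j) (+-monoˡ-< 1 k<))) = refl
    bright : ∀ i → i < d + d + 1 → lit (suc j) (j + j + 1 + i) ≡ j + 2
    bright i _ rewrite dec-true (suc j + suc j ≤? j + j + 1 + i + 1)
      (subst (_≤ j + j + 1 + i + 1) (twice-suc j) (+-monoˡ-≤ 1 (m≤m+n (j + j + 1) i))) = +-comm 2 j

sumBelow-rowLit : ∀ n d → 6 * sumBelow (n + d + (n + d)) (rowLit n) + 4 * n * suc n * (n + 2)
                          ≡ 3 * (n + n + d + d + 1) * n * (n + 3)
sumBelow-rowLit zero d rewrite sumBelow-const (d + d) 0 | *-zeroʳ (d + d) | *-zeroʳ (3 * (d + d + 1)) = refl
sumBelow-rowLit (suc n) d = +-cancelʳ-≡ A _ _ (begin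
    6 * sumBelow K (rowLit (suc n)) + A′ + A
  ≡⟨ cong (λ x → 6 * x + A′ + A) (trans (sumBelow-+ K (lit (suc n)) (rowLit n)) (cong (_+ G) (sumBelow-lit n d))) ⟩
    6 * (X + G) + A′ + A
  ≡⟨ regroup X G A′ A ⟩
    6 * X + A′ + (6 * G + A)
  ≡⟨ cong (6 * X + A′ +_) IH ⟩
    6 * X + A′ + 3 * (n + n + suc d + suc d + 1) * n * (n + 3)
  ≡⟨ step n d ⟩
    3 * (suc n + suc n + d + d + 1) * suc n * (suc n + 3) + A ∎)
  where
    open ≡-Reasoning
    K = suc n + d + (suc n + d)
    G = sumBelow K (rowLit n)
    X = (d + d + 1) * (n + 2)
    A = 4 * n * suc n * (n + 2)
    A′ = 4 * suc n * suc (suc n) * (suc n + 2)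
    IH : 6 * G + A ≡ 3 * (n + n + suc d + suc d + 1) * n * (n + 3)
    IH = subst (λ L → 6 * sumBelow L (rowLit n) + A ≡ 3 * (n + n + suc d + suc d + 1) * n * (n + 3))
           (cong₂ _+_ (+-suc n d) (+-suc n d)) (sumBelow-rowLit n (suc d))
    regroup : ∀ X G A′ A → 6 * (X + G) + A′ + A ≡ 6 * X + A′ + (6 * G + A)
    regroup = solve-∀
    step : ∀ n d → 6 * ((d + d + 1) * (n + 2)) + 4 * suc n * suc (suc n) * (suc n + 2)
                   + 3 * (n + n + suc d + suc d + 1) * n * (n + 3)
                   ≡ 3 * (suc n + suc n + d + d + 1) * suc n * (suc n + 3) + 4 * n * suc n * (n + 2)
    step = solve-∀

triangle : ℕ → ℕ
triangle zero    = 0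
triangle (suc n) = n + triangle n

double-triangle : ∀ n → 2 * triangle (suc n) ≡ n * suc n
double-triangle zero    = refl
double-triangle (suc n) rewrite *-distribˡ-+ 2 (suc n) (triangle (suc n)) | double-triangle n = step n
  where
    step : ∀ n → 2 * suc n + n * suc n ≡ suc n * suc (suc n)
    step = solve-∀

ladder : ℕ → ℕ
ladder zero    = 0
ladder (suc n) = (suc n + 2) + ladder n

double-ladder : ∀ n → 2 * ladder n ≡ n * (n + 5)
double-ladder zero    = refl
double-ladder (suc n) rewrite *-distribˡ-+ 2 (suc n + 2) (ladder n) | double-ladder n = step n
  where
    step : ∀ n → 2 * (suc n + 2) + n * (n + 5) ≡ suc n * (suc n + 5)
    step = solve-∀

staircase-balance : ∀ t₀ → let t = suc t₀ in
  3 * (t + t + sumBelow (t + t) (rowLit t)) + triangle t ≡ (t + t) * suc (ladder t₀ + (t + 4))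
staircase-balance t₀ = *-cancelˡ-≡ _ _ 2 (+-cancelʳ-≡ (4 * t * suc t * (t + 2)) _ _ (begin
    2 * (3 * (t + t + V) + triangle t) + 4 * t * suc t * (t + 2)
  ≡⟨ expandˡ t₀ V (triangle t) ⟩
    12 * t + (6 * V + 4 * t * suc t * (t + 2)) + 2 * triangle t
  ≡⟨ cong₂ (λ x y → 12 * t + x + y) rows (double-triangle t₀) ⟩
    12 * t + 3 * (t + t + 1) * t * (t + 3) + t₀ * t
  ≡⟨ polynomial t₀ ⟩
    4 * t * (t + 5) + (t + t) * (t₀ * (t₀ + 5)) + 4 * t * suc t * (t + 2)
  ≡⟨ cong (λ x → 4 * t * (t + 5) + (t + t) * x + 4 * t * suc t * (t + 2)) (sym (double-ladder t₀)) ⟩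
    4 * t * (t + 5) + (t + t) * (2 * ladder t₀) + 4 * t * suc t * (t + 2)
  ≡⟨ expandʳ t₀ (ladder t₀) ⟩
    2 * ((t + t) * suc (ladder t₀ + (t + 4))) + 4 * t * suc t * (t + 2) ∎))
  where
    open ≡-Reasoning
    t = suc t₀
    V = sumBelow (t + t) (rowLit t)
    rows : 6 * V + 4 * t * suc t * (t + 2) ≡ 3 * (t + t + 1) * t * (t + 3)
    rows = subst₂ (λ K L → 6 * sumBelow K (rowLit t) + 4 * t * suc t * (t + 2) ≡ 3 * (L + 1) * t * (t + 3))
             (cong₂ _+_ (+-identityʳ t) (+-identityʳ t)) (trans (+-identityʳ (t + t + 0)) (+-identityʳ (t + t)))
             (sumBelow-rowLit t 0)
    expandˡ : ∀ t₀ V T → let t = suc t₀ in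
      2 * (3 * (t + t + V) + T) + 4 * t * suc t * (t + 2) ≡ 12 * t + (6 * V + 4 * t * suc t * (t + 2)) + 2 * T
    expandˡ = solve-∀
    polynomial : ∀ t₀ → let t = suc t₀ in
      12 * t + 3 * (t + t + 1) * t * (t + 3) + t₀ * t
        ≡ 4 * t * (t + 5) + (t + t) * (t₀ * (t₀ + 5)) + 4 * t * suc t * (t + 2)
    polynomial = solve-∀
    expandʳ : ∀ t₀ W → let t = suc t₀ in
      4 * t * (t + 5) + (t + t) * (2 * W) + 4 * t * suc t * (t + 2)
        ≡ 2 * ((t + t) * suc (W + (t + 4))) + 4 * t * suc t * (t + 2)
    expandʳ = solve-∀

m+m≤n+n⇒m≤n : ∀ {a b} → a + a ≤ b + b → a ≤ b
m+m≤n+n⇒m≤n h = ≮⇒≥ (λ b<a → <⇒≱ (+-mono-< b<a b<a) h)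

tight-rows : ∀ t₀ K E → let t = suc t₀ in
  K ≤ t + t → E ≤ t₀ → (t + t) + (t + t) ≤ K + 2 + (E + E) → K ≡ t + t × E ≡ t₀
tight-rows t₀ K E K≤ E≤ rows = K≡ , ≤-antisym E≤ (m+m≤n+n⇒m≤n (+-cancelˡ-≤ 2 _ _ (subst₂ _≤_ (twice t₀) refl late)))
  where
    t = suc t₀
    twice : ∀ t₀ → suc t₀ + suc t₀ ≡ 2 + (t₀ + t₀)
    twice = solve-∀
    early : t + t ≤ K
    early = +-cancelʳ-≤ (t + t) (t + t) K (≤-trans rows (begin
      K + 2 + (E + E)     ≤⟨ +-monoʳ-≤ (K + 2) (+-mono-≤ E≤ E≤) ⟩
      K + 2 + (t₀ + t₀)   ≡⟨ trans (+-assoc K 2 _) (cong (K +_) (sym (twice t₀))) ⟩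
      K + (t + t)         ∎))
      where open ≤-Reasoning
    K≡ : K ≡ t + t
    K≡ = ≤-antisym K≤ early
    late : t + t ≤ 2 + (E + E)
    late = +-cancelˡ-≤ (t + t) _ _
      (subst ((t + t) + (t + t) ≤_) (trans (cong (λ k → k + 2 + (E + E)) K≡) (+-assoc (t + t) 2 _)) rows)

module Staircase (t₀ u : ℕ) where

  t s μ m c : ℕ
  t = suc t₀
  s = 4 + t + u
  μ = 6 + t + t₀ * s
  m = μ + u
  c = (t + t₀) * m + μ

  m≡2+t*s : m ≡ 2 + t * s
  m≡2+t*s = expand t₀ u
    where
      expand : ∀ t₀ u → 6 + suc t₀ + t₀ * (4 + suc t₀ + u) + u ≡ 2 + suc t₀ * (4 + suc t₀ + u)
      expand = solve-∀

  t<s : t < s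
  t<s = ≤-trans (m<n+m t {4} z<s) (m≤m+n (4 + t) u)

  t+3<s : t + 3 < s
  t+3<s = subst (_≤ s) (trans (+-comm 4 t) (+-suc t 3)) (m≤m+n (4 + t) u)

  cell : ℕ → ℕ → ℕ → ℕ
  cell k e r = k * m + 2 + e * s + r

  record Live (k e r : ℕ) : Set where
    constructor mkLive
    field
      block  : e < t
      height : r + e ≤ t
      row    : t + t ≤ k + 1 + (e + e)

  live? : ∀ k e r → Dec (Live k e r)
  live? k e r = map′ (λ (b , h , w) → mkLive b h w) (λ (mkLive b h w) → b , h , w)
    ((e <? t) ×-dec (r + e ≤? t) ×-dec (t + t ≤? k + 1 + (e + e)))

  InRow : ℕ → ℕ → Set
  InRow k col = col ≡ 0 ⊎ (2 ≤ col × Live k ((col ∸ 2) / s) ((col ∸ 2) % s))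

  inRow? : ∀ k col → Dec (InRow k col)
  inRow? k col = (col ≟ 0) ⊎-dec ((2 ≤? col) ×-dec live? k ((col ∸ 2) / s) ((col ∸ 2) % s))

  isPattern : ℕ → Bool
  isPattern x = does (inRow? (x / m) (x % m))

  member : ℕ → Bool
  member x = does (c ≤? x) ∨ isPattern x

  cell-column : ∀ k e r → cell k e r ≡ k * m + (2 + (e * s + r))
  cell-column k e r = trans (+-assoc (k * m + 2) (e * s) r) (+-assoc (k * m) 2 (e * s + r))

  column-bound : ∀ {n e r} → e < n → r < s → e * s + r < n * s
  column-bound {n} {e} {r} e<n r<s = begin-strict
    e * s + r <⟨ +-monoʳ-< (e * s) r<s ⟩
    e * s + s ≡⟨ +-comm (e * s) s ⟩
    suc e * s ≤⟨ *-monoˡ-≤ s e<n ⟩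
    n * s ∎
    where open ≤-Reasoning

  isPattern-row : ∀ k col → col < m → isPattern (k * m + col) ≡ does (inRow? k col)
  isPattern-row k col col<m =
    cong₂ (λ a b → does (inRow? a b)) ([kn+r]/n≡k k col m col<m) ([kn+r]%n≡r k col m col<m)

  isPattern-multiple : ∀ k → isPattern (k * m) ≡ true
  isPattern-multiple k = trans (cong isPattern (sym (+-identityʳ (k * m)))) (isPattern-row k 0 z<s)

  isPattern-gap : ∀ k → isPattern (k * m + 1) ≡ false
  isPattern-gap k = isPattern-row k 1 (subst (1 <_) (sym m≡2+t*s) (s≤s z<s))

  isPattern-cell : ∀ k {e r} → e < t → r < s → isPattern (cell k e r) ≡ does (live? k e r)
  isPattern-cell k {e} {r} e<t r<s = begin
    isPattern (cell k e r)
      ≡⟨ cong isPattern (cell-column k e r) ⟩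
    isPattern (k * m + (2 + (e * s + r)))
      ≡⟨ isPattern-row k _ (subst (2 + (e * s + r) <_) (sym m≡2+t*s) (+-monoʳ-< 2 (column-bound e<t r<s))) ⟩
    does (live? k ((e * s + r) / s) ((e * s + r) % s))
      ≡⟨ cong₂ (λ a b → does (live? k a b)) ([kn+r]/n≡k e r s r<s) ([kn+r]%n≡r e r s r<s) ⟩
    does (live? k e r) ∎
    where open ≡-Reasoning

  live⇒r<s : ∀ {k e r} → Live k e r → r < s
  live⇒r<s (mkLive _ r+e≤t _) = ≤-<-trans (m+n≤o⇒m≤o _ r+e≤t) t<s

  ¬live-tall : ∀ {k e r} → t < r + e → ¬ Live k e r
  ¬live-tall tall l = <⇒≱ tall (Live.height l)

  live⇒0<k : ∀ {k e r} → Live k e r → 0 < k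
  live⇒0<k {zero} {e} (mkLive e<t _ row) = contradiction row (<⇒≱ (subst (_≤ t + t) (shift e) (+-mono-≤ e<t e<t)))
    where
      shift : ∀ e → suc e + suc e ≡ suc (0 + 1 + (e + e))
      shift = solve-∀
  live⇒0<k {suc k} _ = z<s

  data InPattern (x : ℕ) : Set where
    multiple : ∀ k → x ≡ k * m → InPattern x
    live     : ∀ {k e r} → Live k e r → x ≡ cell k e r → InPattern x

  InPattern⇒isPattern : ∀ {x} → InPattern x → isPattern x ≡ true
  InPattern⇒isPattern (multiple k refl) = isPattern-multiple k
  InPattern⇒isPattern (live {k} {e} {r} l refl) =
    trans (isPattern-cell k (Live.block l) (live⇒r<s l)) (dec-true (live? k e r) l)

  isPattern⇒InPattern : ∀ x → isPattern x ≡ true → InPattern x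
  isPattern⇒InPattern x h with does⇒witness (inRow? (x / m) (x % m)) h
  ... | inj₁ col≡0 = multiple (x / m) (trans (m≡m%n+[m/n]*n x m) (cong (_+ x / m * m) col≡0))
  ... | inj₂ (2≤col , l) = live {k = x / m} {e = (x % m ∸ 2) / s} {r = (x % m ∸ 2) % s} l (begin
        x                                    ≡⟨ m≡m%n+[m/n]*n x m ⟩
        x % m + x / m * m                    ≡⟨ cong (_+ x / m * m) (sym (m+[n∸m]≡n 2≤col)) ⟩
        2 + y + x / m * m                    ≡⟨ cong (λ z → 2 + z + x / m * m) (m≡m%n+[m/n]*n y s) ⟩
        2 + (y % s + y / s * s) + x / m * m  ≡⟨ reorder (y % s) (y / s * s) (x / m * m) ⟩
        cell (x / m) (y / s) (y % s)         ∎)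
    where
      open ≡-Reasoning
      y = x % m ∸ 2
      reorder : ∀ a b c → 2 + (a + b) + c ≡ c + 2 + b + a
      reorder = solve-∀

  data PatternSum (z : ℕ) : Set where
    inside : InPattern z → PatternSum z
    corner : ∀ R → R ≤ t + 1 → z ≡ cell (t + t) t₀ (2 + R) → PatternSum z
    beyond : suc (t + t) * m ≤ z → PatternSum z

  cell-+ : ∀ k₁ e₁ r₁ k₂ e₂ r₂ → cell k₁ e₁ r₁ + cell k₂ e₂ r₂ ≡ (k₁ + k₂) * m + 4 + (e₁ + e₂) * s + (r₁ + r₂)
  cell-+ k₁ e₁ r₁ k₂ e₂ r₂ = expand k₁ e₁ r₁ k₂ e₂ r₂ m s
    where
      expand : ∀ k₁ e₁ r₁ k₂ e₂ r₂ M S → (k₁ * M + 2 + e₁ * S + r₁) + (k₂ * M + 2 + e₂ * S + r₂)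
                                          ≡ (k₁ + k₂) * M + 4 + (e₁ + e₂) * S + (r₁ + r₂)
      expand = solve-∀

  rows-+ : ∀ {k₁ e₁ r₁ k₂ e₂ r₂} → Live k₁ e₁ r₁ → Live k₂ e₂ r₂ →
           (t + t) + (t + t) ≤ (k₁ + k₂) + 2 + ((e₁ + e₂) + (e₁ + e₂))
  rows-+ {k₁} {e₁} {_} {k₂} {e₂} (mkLive _ _ row₁) (mkLive _ _ row₂) =
    subst ((t + t) + (t + t) ≤_) (regroup k₁ e₁ k₂ e₂) (+-mono-≤ row₁ row₂)
    where
      regroup : ∀ k₁ e₁ k₂ e₂ → k₁ + 1 + (e₁ + e₁) + (k₂ + 1 + (e₂ + e₂)) ≡ (k₁ + k₂) + 2 + ((e₁ + e₂) + (e₁ + e₂))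
      regroup = solve-∀

  multiple-+-live : ∀ j {k e r} → Live k e r → InPattern (j * m + cell k e r)
  multiple-+-live j {k} {e} {r} (mkLive e<t r+e≤t row) =
    live {k = j + k} (mkLive e<t r+e≤t (≤-trans row (+-monoˡ-≤ (e + e) (+-monoˡ-≤ 1 (m≤n+m k j)))))
      (regroup j k m e s r)
    where
      regroup : ∀ j k M e S r → j * M + (k * M + 2 + e * S + r) ≡ (j + k) * M + 2 + e * S + r
      regroup = solve-∀

  cell-+-carry : ∀ k₁ e₁ r₁ k₂ e₂ r₂ {e} → e₁ + e₂ ≡ t + e →
                 cell k₁ e₁ r₁ + cell k₂ e₂ r₂ ≡ cell (k₁ + k₂ + 1) e (r₁ + r₂)
  cell-+-carry k₁ e₁ r₁ k₂ e₂ r₂ {e} carry = begin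
    cell k₁ e₁ r₁ + cell k₂ e₂ r₂
      ≡⟨ cell-+ k₁ e₁ r₁ k₂ e₂ r₂ ⟩
    (k₁ + k₂) * m + 4 + (e₁ + e₂) * s + (r₁ + r₂)
      ≡⟨ cong₂ (λ M x → (k₁ + k₂) * M + 4 + x * s + (r₁ + r₂)) m≡2+t*s carry ⟩
    (k₁ + k₂) * (2 + t * s) + 4 + (t + e) * s + (r₁ + r₂)
      ≡⟨ carry-row (k₁ + k₂) t e s (r₁ + r₂) ⟩
    (k₁ + k₂ + 1) * (2 + t * s) + 2 + e * s + (r₁ + r₂)
      ≡⟨ cong (λ M → (k₁ + k₂ + 1) * M + 2 + e * s + (r₁ + r₂)) (sym m≡2+t*s) ⟩
    cell (k₁ + k₂ + 1) e (r₁ + r₂) ∎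
    where
      open ≡-Reasoning
      carry-row : ∀ K t e s R → K * (2 + t * s) + 4 + (t + e) * s + R ≡ (K + 1) * (2 + t * s) + 2 + e * s + R
      carry-row = solve-∀

  live-+-carry : ∀ {k₁ e₁ r₁ k₂ e₂ r₂ e} → Live k₁ e₁ r₁ → Live k₂ e₂ r₂ → e₁ + e₂ ≡ t + e →
                 InPattern (cell k₁ e₁ r₁ + cell k₂ e₂ r₂)
  live-+-carry {k₁} {e₁} {r₁} {k₂} {e₂} {r₂} {e} l₁@(mkLive e₁<t h₁ _) l₂@(mkLive e₂<t h₂ _) carry =
    live {k = k₁ + k₂ + 1} (mkLive e<t height row) (cell-+-carry k₁ e₁ r₁ k₂ e₂ r₂ carry)
    where
      e<t : e < t
      e<t = +-cancelˡ-< t e t (begin-strict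
        t + e     ≡⟨ sym carry ⟩
        e₁ + e₂   <⟨ +-monoʳ-< e₁ e₂<t ⟩
        e₁ + t    ≤⟨ +-monoˡ-≤ t (≤-trans (n≤1+n e₁) e₁<t) ⟩
        t + t     ∎)
        where open ≤-Reasoning
      height : r₁ + r₂ + e ≤ t
      height = +-cancelʳ-≤ t (r₁ + r₂ + e) t (begin
        r₁ + r₂ + e + t       ≡⟨ regroup r₁ r₂ e t ⟩
        r₁ + r₂ + (t + e)     ≡⟨ cong (r₁ + r₂ +_) (sym carry) ⟩
        r₁ + r₂ + (e₁ + e₂)   ≡⟨ interleave r₁ r₂ e₁ e₂ ⟩
        (r₁ + e₁) + (r₂ + e₂) ≤⟨ +-mono-≤ h₁ h₂ ⟩
        t + t                 ∎)
        where
          open ≤-Reasoning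
          regroup : ∀ a b e t → a + b + e + t ≡ a + b + (t + e)
          regroup = solve-∀
          interleave : ∀ a b c d → a + b + (c + d) ≡ a + c + (b + d)
          interleave = solve-∀
      row : t + t ≤ k₁ + k₂ + 1 + 1 + (e + e)
      row = +-cancelʳ-≤ (t + t) (t + t) _ (begin
        (t + t) + (t + t)                          ≤⟨ rows-+ l₁ l₂ ⟩
        k₁ + k₂ + 2 + ((e₁ + e₂) + (e₁ + e₂))      ≡⟨ cong (λ x → k₁ + k₂ + 2 + (x + x)) carry ⟩
        k₁ + k₂ + 2 + ((t + e) + (t + e))          ≡⟨ regroup (k₁ + k₂) t e ⟩
        k₁ + k₂ + 1 + 1 + (e + e) + (t + t)        ∎)
        where
          open ≤-Reasoning
          regroup : ∀ K t e → K + 2 + (t + e + (t + e)) ≡ K + 1 + 1 + (e + e) + (t + t)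
          regroup = solve-∀

  row-start : ∀ k e r → k * m ≤ cell k e r
  row-start k e r = ≤-trans (≤-trans (m≤m+n (k * m) 2) (m≤m+n (k * m + 2) (e * s))) (m≤m+n (k * m + 2 + e * s) r)

  live-+-no-carry : ∀ {k₁ e₁ r₁ k₂ e₂ r₂} → Live k₁ e₁ r₁ → Live k₂ e₂ r₂ → e₁ + e₂ < t →
                    PatternSum (cell k₁ e₁ r₁ + cell k₂ e₂ r₂)
  live-+-no-carry {k₁} {e₁} {r₁} {k₂} {e₂} {r₂} l₁ l₂ no-carry with suc (t + t) ≤? k₁ + k₂
  ... | yes far = beyond (≤-trans (*-monoˡ-≤ m far)
        (subst (_≤ cell k₁ e₁ r₁ + cell k₂ e₂ r₂) (sym (*-distribʳ-+ m k₁ k₂))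
          (+-mono-≤ (row-start k₁ e₁ r₁) (row-start k₂ e₂ r₂))))
  ... | no near with tight-rows t₀ (k₁ + k₂) (e₁ + e₂) (≤-pred (≰⇒> near)) (≤-pred no-carry) (rows-+ l₁ l₂)
  ...   | K≡ , E≡ = corner (r₁ + r₂) R≤ sum≡
    where
      sum≡ : cell k₁ e₁ r₁ + cell k₂ e₂ r₂ ≡ cell (t + t) t₀ (2 + (r₁ + r₂))
      sum≡ = begin
        cell k₁ e₁ r₁ + cell k₂ e₂ r₂                  ≡⟨ cell-+ k₁ e₁ r₁ k₂ e₂ r₂ ⟩
        (k₁ + k₂) * m + 4 + (e₁ + e₂) * s + (r₁ + r₂)  ≡⟨ cong₂ (λ K E → K * m + 4 + E * s + (r₁ + r₂)) K≡ E≡ ⟩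
        (t + t) * m + 4 + t₀ * s + (r₁ + r₂)           ≡⟨ regroup ((t + t) * m) (t₀ * s) (r₁ + r₂) ⟩
        cell (t + t) t₀ (2 + (r₁ + r₂))                ∎
        where
          open ≡-Reasoning
          regroup : ∀ a b c → a + 4 + b + c ≡ a + 2 + b + (2 + c)
          regroup = solve-∀
      R≤ : r₁ + r₂ ≤ t + 1
      R≤ = +-cancelʳ-≤ t₀ (r₁ + r₂) (t + 1) (begin
        r₁ + r₂ + t₀           ≡⟨ cong (r₁ + r₂ +_) (sym E≡) ⟩
        r₁ + r₂ + (e₁ + e₂)    ≡⟨ interleave r₁ r₂ e₁ e₂ ⟩
        (r₁ + e₁) + (r₂ + e₂)  ≤⟨ +-mono-≤ (Live.height l₁) (Live.height l₂) ⟩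
        t + t                  ≡⟨ regroup′ t₀ ⟩
        t + 1 + t₀             ∎)
        where
          open ≤-Reasoning
          interleave : ∀ a b c d → a + b + (c + d) ≡ a + c + (b + d)
          interleave = solve-∀
          regroup′ : ∀ t₀ → suc t₀ + suc t₀ ≡ suc t₀ + 1 + t₀
          regroup′ = solve-∀

  pattern-+ : ∀ {w y} → InPattern w → InPattern y → PatternSum (w + y)
  pattern-+ (multiple j refl) (multiple k refl) = inside (multiple (j + k) (sym (*-distribʳ-+ m j k)))
  pattern-+ (multiple j refl) (live l refl) = inside (multiple-+-live j l)
  pattern-+ {w} (live l refl) (multiple j refl) = subst PatternSum (+-comm (j * m) w) (inside (multiple-+-live j l))
  pattern-+ (live {e = e₁} l₁ refl) (live {e = e₂} l₂ refl) with t ≤? e₁ + e₂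
  ... | yes carry = inside (live-+-carry l₁ l₂ (sym (m+[n∸m]≡n carry)))
  ... | no no-carry = live-+-no-carry l₁ l₂ (≰⇒> no-carry)

  member-above : ∀ {x} → c ≤ x → member x ≡ true
  member-above {x} c≤x rewrite dec-true (c ≤? x) c≤x = refl

  member-below : ∀ {x} → x < c → member x ≡ isPattern x
  member-below {x} x<c rewrite dec-false (c ≤? x) (<⇒≱ x<c) = refl

  isPattern⇒member : ∀ x → isPattern x ≡ true → member x ≡ true
  isPattern⇒member x h rewrite h = ∨-zeroʳ (does (c ≤? x))

  member-cases : ∀ {x} → member x ≡ true → c ≤ x ⊎ isPattern x ≡ true
  member-cases {x} = by-cases (c ≤? x)
    where
      by-cases : (d : Dec (c ≤ x)) → does d ∨ isPattern x ≡ true → c ≤ x ⊎ isPattern x ≡ true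
      by-cases (yes c≤x) _ = inj₁ c≤x
      by-cases (no  _)   h = inj₂ h

  c+u≡2t*m : c + u ≡ (t + t) * m
  c+u≡2t*m = regroup t₀ μ u
    where
      regroup : ∀ t₀ μ u → (suc t₀ + t₀) * (μ + u) + μ + u ≡ (suc t₀ + suc t₀) * (μ + u)
      regroup = solve-∀

  c≤2t*m : c ≤ (t + t) * m
  c≤2t*m = subst (c ≤_) c+u≡2t*m (m≤m+n c u)

  PatternSum⇒member : ∀ {z} → PatternSum z → member z ≡ true
  PatternSum⇒member {z} (inside p) = isPattern⇒member z (InPattern⇒isPattern p)
  PatternSum⇒member (corner R _ refl) = member-above (≤-trans c≤2t*m (row-start (t + t) t₀ (2 + R)))
  PatternSum⇒member (beyond far) = member-above (≤-trans c≤2t*m (≤-trans (m≤n+m _ m) far))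

  member-+ : ∀ a b → member a ≡ true → member b ≡ true → member (a + b) ≡ true
  member-+ a b ha hb with member-cases ha | member-cases hb
  ... | inj₁ c≤a | _         = member-above (≤-trans c≤a (m≤m+n a b))
  ... | inj₂ _   | inj₁ c≤b  = member-above (≤-trans c≤b (m≤n+m b a))
  ... | inj₂ pa  | inj₂ pb   =
    PatternSum⇒member (pattern-+ (isPattern⇒InPattern a pa) (isPattern⇒InPattern b pb))

  S : NumericalSemigroup
  S = record
    { mem      = member
    ; zero∈    = isPattern⇒member 0 (isPattern-multiple 0)
    ; closed   = member-+
    ; cofinite = c , λ _ → member-above
    }

  last-gap : ℕ
  last-gap = cell (t + t₀) t₀ (t + 3)

  c≡1+last-gap : c ≡ suc last-gap
  c≡1+last-gap = regroup ((t + t₀) * m) t (t₀ * s)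
    where
      regroup : ∀ a t b → a + (6 + t + b) ≡ suc (a + 2 + b + (t + 3))
      regroup = solve-∀

  last-gap-∉ : member last-gap ≡ false
  last-gap-∉ = begin
    member last-gap                               ≡⟨ member-below (subst (last-gap <_) (sym c≡1+last-gap) ≤-refl) ⟩
    isPattern last-gap                            ≡⟨ isPattern-cell (t + t₀) ≤-refl t+3<s ⟩
    does (live? (t + t₀) t₀ (t + 3))              ≡⟨ dec-false (live? (t + t₀) t₀ (t + 3)) too-high ⟩
    false                                         ∎
    where
      open ≡-Reasoning
      too-high : ¬ Live (t + t₀) t₀ (t + 3)
      too-high = ¬live-tall (subst (t <_) (sym (+-assoc t 3 t₀)) (m<m+n t z<s))

  conductor : IsConductor S c
  conductor = (λ _ → member-above) , least
    where
      least : ∀ d → (∀ k → d ≤ k → member k ≡ true) → c ≤ d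
      least d above with c ≤? d
      ... | yes c≤d = c≤d
      ... | no  c≰d =
        contradiction (trans (sym (above last-gap (≤-pred (subst (d <_) c≡1+last-gap (≰⇒> c≰d))))) last-gap-∉) λ ()

  m≤c : m ≤ c
  m≤c = ≤-trans (m≤m+n m ((t₀ + t₀) * m)) (m≤m+n ((t + t₀) * m) μ)

  multiplicity : IsMultiplicity S m
  multiplicity =
    z<s , isPattern⇒member m (subst (λ x → isPattern x ≡ true) (*-identityˡ m) (isPattern-multiple 1)) , least
    where
      least : ∀ x → 0 < x → member x ≡ true → m ≤ x
      least x 0<x hx with member-cases hx
      ... | inj₁ c≤x = ≤-trans m≤c c≤x
      ... | inj₂ px with isPattern⇒InPattern x px
      ...   | multiple zero    refl = contradiction 0<x (<-irrefl refl)
      ...   | multiple (suc j) refl = m≤m+n m (j * m)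
      ...   | live {k} {e} {r} l refl =
        ≤-trans (subst (_≤ k * m) (*-identityˡ m) (*-monoˡ-≤ m (live⇒0<k l))) (row-start k e r)

  twice-block : ∀ {j e} → j + e ≡ t → t + t ≡ (j + j) + (e + e)
  twice-block {j} {e} j+e≡t = trans (cong₂ _+_ (sym j+e≡t) (sym j+e≡t)) (interleave j e)
    where
      interleave : ∀ j e → (j + e) + (j + e) ≡ (j + j) + (e + e)
      interleave = solve-∀

  block-count : ∀ k n e → suc n + e ≡ t → count isPattern (k * m + 2 + e * s) s ≡ lit (suc n) k
  block-count k n e j+e≡t = by-cases (suc n + suc n ≤? k + 1)
    where
      j = suc n
      base = k * m + 2 + e * s
      e<t : e < t
      e<t = subst (e <_) j+e≡t (s≤s (m≤n+m e n))
      j<s : j < s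
      j<s = ≤-<-trans (subst (j ≤_) j+e≡t (m≤m+n j e)) t<s
      by-cases : (d : Dec (j + j ≤ k + 1)) → count isPattern base s ≡ (if does d then suc j else 0)
      by-cases (yes early) = trans (cong (count isPattern base) (sym (m+[n∸m]≡n j<s)))
          (count-prefix isPattern base (suc j) (s ∸ suc j) lit-cells dark-cells)
        where
          row : t + t ≤ k + 1 + (e + e)
          row = subst (_≤ k + 1 + (e + e)) (sym (twice-block {j} {e} j+e≡t)) (+-monoˡ-≤ (e + e) early)
          lit-cells : Window (λ i → isPattern i ≡ true) base (suc j)
          lit-cells r r≤j = trans (isPattern-cell k e<t (≤-<-trans (≤-pred r≤j) j<s))
            (dec-true (live? k e r) (mkLive e<t (subst (r + e ≤_) j+e≡t (+-monoˡ-≤ e (≤-pred r≤j))) row))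
          dark-cells : Window (λ i → isPattern i ≡ false) (base + suc j) (s ∸ suc j)
          dark-cells r r< = trans (cong isPattern (+-assoc base (suc j) r))
            (trans (isPattern-cell k e<t (subst (suc j + r <_) (m+[n∸m]≡n j<s) (+-monoʳ-< (suc j) r<)))
              (dec-false (live? k e (suc j + r)) λ l →
                <⇒≱ (subst (_< suc j + r + e) j+e≡t (+-monoˡ-≤ e (s≤s (m≤m+n j r)))) (Live.height l)))
      by-cases (no late) = count-none isPattern base s λ r r<s →
        trans (isPattern-cell k e<t r<s) (dec-false (live? k e r) λ l → late (+-cancelʳ-≤ (e + e) (j + j) (k + 1)
          (subst (_≤ k + 1 + (e + e)) (twice-block {j} {e} j+e≡t) (Live.row l))))

  blocks-count : ∀ k n e → n + e ≡ t → count isPattern (k * m + 2 + e * s) (n * s) ≡ rowLit n k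
  blocks-count k zero    e _      = refl
  blocks-count k (suc n) e n+e≡t = begin
    count isPattern (k * m + 2 + e * s) (s + n * s)
      ≡⟨ count-++ isPattern (k * m + 2 + e * s) s (n * s) ⟩
    count isPattern (k * m + 2 + e * s) s + count isPattern (k * m + 2 + e * s + s) (n * s)
      ≡⟨ cong₂ _+_ (block-count k n e n+e≡t) (cong (λ x → count isPattern x (n * s)) (next-block (k * m) e s)) ⟩
    lit (suc n) k + count isPattern (k * m + 2 + suc e * s) (n * s)
      ≡⟨ cong (lit (suc n) k +_) (blocks-count k n (suc e) (trans (+-suc n e) n+e≡t)) ⟩
    lit (suc n) k + rowLit n k ∎
    where
      open ≡-Reasoning
      next-block : ∀ a e s → a + 2 + e * s + s ≡ a + 2 + suc e * s
      next-block = solve-∀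

  row-count : ∀ k → count isPattern (k * m) m ≡ suc (rowLit t k)
  row-count k = begin
    count isPattern (k * m) m
      ≡⟨ cong (count isPattern (k * m)) m≡2+t*s ⟩
    count isPattern (k * m) (2 + t * s)
      ≡⟨ cong₂ (λ a b → (if a then 1 else 0) + ((if b then 1 else 0) + count isPattern (2 + k * m) (t * s)))
           (isPattern-multiple k) (trans (cong isPattern (+-comm 1 (k * m))) (isPattern-gap k)) ⟩
    1 + count isPattern (2 + k * m) (t * s)
      ≡⟨ cong (λ x → 1 + count isPattern x (t * s)) (first-block (k * m) s) ⟩
    1 + count isPattern (k * m + 2 + 0 * s) (t * s)
      ≡⟨ cong suc (blocks-count k t 0 (+-identityʳ t)) ⟩
    suc (rowLit t k) ∎
    where
      open ≡-Reasoning
      first-block : ∀ a s → 2 + a ≡ a + 2 + 0 * s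
      first-block = solve-∀

  isPattern-above-conductor : ∀ r → r < u → isPattern (c + r) ≡ false
  isPattern-above-conductor r r<u = begin
    isPattern (c + r)
      ≡⟨ cong isPattern (regroup ((t + t₀) * m) t (t₀ * s) r) ⟩
    isPattern (cell (t + t₀) t₀ (t + 4 + r))
      ≡⟨ isPattern-cell (t + t₀) ≤-refl (<-≤-trans (+-monoʳ-< (t + 4) r<u) wide) ⟩
    does (live? (t + t₀) t₀ (t + 4 + r))
      ≡⟨ dec-false (live? (t + t₀) t₀ (t + 4 + r)) (¬live-tall (subst (t <_) (tall t r t₀) (m<m+n t z<s))) ⟩
    false ∎
    where
      open ≡-Reasoning
      regroup : ∀ a t b r → a + (6 + t + b) + r ≡ a + 2 + b + (t + 4 + r)
      regroup = solve-∀
      wide : t + 4 + u ≤ s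
      wide = ≤-reflexive (cong (_+ u) (+-comm t 4))
      tall : ∀ t r t₀ → t + suc (3 + r + t₀) ≡ t + 4 + r + t₀
      tall = solve-∀

  count-L : count member 0 c ≡ t + t + sumBelow (t + t) (rowLit t)
  count-L = begin
    count member 0 c
      ≡⟨ count-cong member isPattern 0 c (λ r r<c → member-below r<c) ⟩
    count isPattern 0 c
      ≡⟨ sym (+-identityʳ _) ⟩
    count isPattern 0 c + 0
      ≡⟨ cong (count isPattern 0 c +_) (sym (count-none isPattern c u isPattern-above-conductor)) ⟩
    count isPattern 0 c + count isPattern c u
      ≡⟨ sym (count-++ isPattern 0 c u) ⟩
    count isPattern 0 (c + u)
      ≡⟨ cong (count isPattern 0) c+u≡2t*m ⟩
    count isPattern 0 ((t + t) * m)
      ≡⟨ count-rows isPattern 0 (t + t) m ⟩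
    sumBelow (t + t) (λ k → count isPattern (k * m) m)
      ≡⟨ sumBelow-cong (t + t) (λ k _ → row-count k) ⟩
    sumBelow (t + t) (λ k → 1 + rowLit t k)
      ≡⟨ sumBelow-+ (t + t) (λ _ → 1) (rowLit t) ⟩
    sumBelow (t + t) (λ _ → 1) + sumBelow (t + t) (rowLit t)
      ≡⟨ cong (_+ sumBelow (t + t) (rowLit t)) (trans (sumBelow-const (t + t) 1) (*-identityʳ (t + t))) ⟩
    t + t + sumBelow (t + t) (rowLit t) ∎
    where open ≡-Reasoning

  cell-positive : ∀ k e r → 0 < cell k e r
  cell-positive k e r = <-≤-trans z<s (≤-trans (m≤n+m 2 (k * m)) (≤-trans (m≤m+n _ (e * s)) (m≤m+n _ r)))

  member-live : ∀ {k e r} → Live k e r → member (cell k e r) ≡ true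
  member-live {k} {e} {r} l = isPattern⇒member (cell k e r) (InPattern⇒isPattern (live l refl))

  member-multiple : ∀ k → member (k * m) ≡ true
  member-multiple k = isPattern⇒member (k * m) (isPattern-multiple k)

  member-m : member m ≡ true
  member-m = proj₁ (proj₂ multiplicity)

  a : ℕ
  a = cell 1 t₀ 0

  first-live : ∀ {r} → r ≤ 1 → Live 1 t₀ r
  first-live r≤1 = mkLive ≤-refl (+-monoˡ-≤ t₀ r≤1) (≤-reflexive (twice t₀))
    where
      twice : ∀ t₀ → suc t₀ + suc t₀ ≡ 1 + 1 + (t₀ + t₀)
      twice = solve-∀

  row-one-live : ∀ {e r} → Live 1 e r → e ≡ t₀ × r ≤ 1
  row-one-live {e} {r} (mkLive e<t height row) = e≡t₀ , +-cancelʳ-≤ t₀ r 1 (subst (λ x → r + x ≤ t) e≡t₀ height)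
    where
      twice : ∀ t₀ → suc t₀ + suc t₀ ≡ 1 + 1 + (t₀ + t₀)
      twice = solve-∀
      e≡t₀ : e ≡ t₀
      e≡t₀ = ≤-antisym (≤-pred e<t) (m+m≤n+n⇒m≤n (+-cancelˡ-≤ 2 _ _ (subst (_≤ 1 + 1 + (e + e)) (twice t₀) row)))

  cell-next-row : ∀ k e r → m + cell k e r ≡ cell (suc k) e r
  cell-next-row k e r = regroup m (k * m) (e * s) r
    where
      regroup : ∀ a b c d → a + (b + 2 + c + d) ≡ a + b + 2 + c + d
      regroup = solve-∀

  -- Either the cell also lies in the staircase one row up, and is m plus that cell, or its row bound
  -- is tight, and it is a or a + 1 plus a cell of the next block two rows up.
  live-row≥2-not-generator : ∀ K {e r} → Live (suc (suc K)) e r → isMinGen S (cell (suc (suc K)) e r) ≡ false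
  live-row≥2-not-generator K {e} {r} l with live? (suc K) e r
  ... | yes l′ = subst (λ z → isMinGen S z ≡ false) (cell-next-row (suc K) e r)
                   (isMinGen-+ S m (cell (suc K) e r) z<s (cell-positive (suc K) e r) member-m (member-live l′))
  ... | no ¬l′ = split r (Live.height l)
    where
      tight : t + t ≡ suc (suc K) + 1 + (e + e)
      tight = ≤-antisym (Live.row l) (≰⇒> λ row′ → ¬l′ (mkLive (Live.block l) (Live.height l) row′))
      e+1<t : suc e < t
      e+1<t = ≰⇒> λ t≤e+1 → <⇒≱ taller (subst (_≤ suc e + suc e) tight (+-mono-≤ t≤e+1 t≤e+1))
        where
          twice : ∀ e → suc e + suc e ≡ 2 + (e + e)
          twice = solve-∀
          regroup : ∀ K e → K + (3 + (e + e)) ≡ suc (suc K) + 1 + (e + e)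
          regroup = solve-∀
          taller : suc e + suc e < suc (suc K) + 1 + (e + e)
          taller = subst₂ _<_ (sym (twice e)) (regroup K e) (m≤n+m (3 + (e + e)) K)
      below : ∀ {r′} → r′ + suc e ≤ t → Live K (suc e) r′
      below h = mkLive e+1<t h (≤-reflexive (trans tight (regroup K e)))
        where
          regroup : ∀ K e → suc (suc K) + 1 + (e + e) ≡ K + 1 + (suc e + suc e)
          regroup = solve-∀
      via-first-row : ∀ r₁ r₂ → r₁ ≤ 1 → Live K (suc e) r₂ → isMinGen S (cell (suc (suc K)) e (r₁ + r₂)) ≡ false
      via-first-row r₁ r₂ r₁≤1 l₂ =
        subst (λ z → isMinGen S z ≡ false)
          (trans (cell-+-carry 1 t₀ r₁ K (suc e) r₂ (+-suc t₀ e)) (cong (λ k → cell (suc k) e (r₁ + r₂)) (+-comm K 1)))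
          (isMinGen-+ S (cell 1 t₀ r₁) (cell K (suc e) r₂) (cell-positive 1 t₀ r₁) (cell-positive K (suc e) r₂)
            (member-live (first-live r₁≤1)) (member-live l₂))
      split : ∀ r → r + e ≤ t → isMinGen S (cell (suc (suc K)) e r) ≡ false
      split zero     _ = via-first-row 0 0 z≤n (below (<⇒≤ e+1<t))
      split (suc r′) h = via-first-row 1 r′ (s≤s z≤n) (below (subst (_≤ t) (sym (+-suc r′ e)) h))

  pattern-generators : ∀ {z} → InPattern z → isMinGen S z ≡ true → z ≡ m ⊎ z ≡ a ⊎ z ≡ suc a
  pattern-generators (multiple zero refl) g = contradiction (trans (sym g) (isMinGen-zero S)) λ ()
  pattern-generators (multiple (suc zero) refl) _ = inj₁ (+-identityʳ m)
  pattern-generators (multiple (suc (suc j)) refl) g =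
    contradiction (trans (sym g) (isMinGen-+ S m (suc j * m) z<s (<-≤-trans z<s (m≤m+n m (j * m)))
      member-m (member-multiple (suc j)))) λ ()
  pattern-generators (live {zero} l refl) _ = contradiction (live⇒0<k l) (<-irrefl refl)
  pattern-generators (live {suc zero} l refl) _ with row-one-live l
  ... | refl , z≤n     = inj₂ (inj₁ refl)
  ... | refl , s≤s z≤n = inj₂ (inj₂ (+-suc (m + 0 + 2 + t₀ * s) 0))
  pattern-generators (live {suc (suc K)} l refl) g = contradiction (trans (sym g) (live-row≥2-not-generator K l)) λ ()

  generators-below-c : ∀ {z} → z < c → isMinGen S z ≡ true → z ≡ m ⊎ z ≡ a ⊎ z ≡ suc a
  generators-below-c {z} z<c g =
    pattern-generators (isPattern⇒InPattern z (trans (sym (member-below z<c)) (isMinGen⇒member S z g))) g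

  not-generator : ∀ {z} → z < c → z ≢ m → z ≢ a → z ≢ suc a → isMinGen S z ≡ false
  not-generator {z} z<c ≢m ≢a ≢a+1 with isMinGen S z in g
  ... | false = refl
  ... | true with generators-below-c z<c g
  ...   | inj₁ z≡m          = contradiction z≡m ≢m
  ...   | inj₂ (inj₁ z≡a)   = contradiction z≡a ≢a
  ...   | inj₂ (inj₂ z≡a+1) = contradiction z≡a+1 ≢a+1

  a≡m+2+t₀*s : a ≡ m + (2 + t₀ * s)
  a≡m+2+t₀*s = regroup m (t₀ * s)
    where
      regroup : ∀ M X → 1 * M + 2 + X + 0 ≡ M + (2 + X)
      regroup = solve-∀

  a+2≤m+m : suc (suc a) ≤ m + m
  a+2≤m+m = subst (_≤ m + m) (sym (regroup m (t₀ * s))) (+-monoʳ-≤ m short)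
    where
      regroup : ∀ M X → suc (suc (1 * M + 2 + X + 0)) ≡ M + (4 + X)
      regroup = solve-∀
      short : 4 + t₀ * s ≤ m
      short = subst (4 + t₀ * s ≤_) (regroup′ t t₀ s u) (m≤m+n (4 + t₀ * s) (2 + t + u))
        where
          regroup′ : ∀ t t₀ s u → 4 + t₀ * s + (2 + t + u) ≡ 6 + t + t₀ * s + u
          regroup′ = solve-∀

  generator-below-2m : ∀ {z} → member z ≡ true → 0 < z → z < m + m → isMinGen S z ≡ true
  generator-below-2m = isMinGen-below-twice-multiplicity S multiplicity

  m≤a : m ≤ a
  m≤a = subst (m ≤_) (sym a≡m+2+t₀*s) (m≤m+n m _)

  gap-above-a : ℕ
  gap-above-a = (t₀ + t₀) * m + (2 + t)

  c≡a+2+gap : c ≡ suc (suc a) + gap-above-a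
  c≡a+2+gap = regroup t₀ m s
    where
      regroup : ∀ t₀ M S → (suc t₀ + t₀) * M + (6 + suc t₀ + t₀ * S)
                            ≡ suc (suc (1 * M + 2 + t₀ * S + 0)) + ((t₀ + t₀) * M + (2 + suc t₀))
      regroup = solve-∀

  count-generators-L : count (isMinGen S) 0 c ≡ 3
  count-generators-L = begin
    count G 0 c
      ≡⟨ cong (count G 0) c-split ⟩
    count G 0 (m + suc (suc (t₀ * s) + suc (suc gap-above-a)))
      ≡⟨ count-next-hit G 0 m _ below-m (generator-below-2m member-m z<s (m<m+n m z<s)) ⟩
    suc (count G (suc m) (suc (t₀ * s) + suc (suc gap-above-a)))
      ≡⟨ cong suc (count-next-hit G (suc m) (suc (t₀ * s)) _ between-m-a (subst (λ z → G z ≡ true) (sym hit-a) G-a)) ⟩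
    2 + count G (suc (suc m + suc (t₀ * s))) (suc gap-above-a)
      ≡⟨ cong (λ b → 2 + count G (suc b) (suc gap-above-a)) hit-a ⟩
    2 + count G (suc a) (suc gap-above-a)
      ≡⟨ cong (λ x → 2 + ((if x then 1 else 0) + count G (suc (suc a)) gap-above-a)) G-a+1 ⟩
    3 + count G (suc (suc a)) gap-above-a
      ≡⟨ cong (3 +_) (count-none G (suc (suc a)) gap-above-a above-a+1) ⟩
    3 ∎
    where
      open ≡-Reasoning
      G = isMinGen S
      hit-a : suc m + suc (t₀ * s) ≡ a
      hit-a = trans (sym (+-suc m (suc (t₀ * s)))) (sym a≡m+2+t₀*s)
      c-split : c ≡ m + suc (suc (t₀ * s) + suc (suc gap-above-a))
      c-split = trans c≡a+2+gap (trans (cong (λ x → suc (suc x) + gap-above-a) (sym hit-a)) (regroup m (t₀ * s) gap-above-a))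
        where
          regroup : ∀ M X g → suc (suc (suc M + suc X)) + g ≡ M + suc (suc X + suc (suc g))
          regroup = solve-∀
      a+2≤c : suc (suc a) ≤ c
      a+2≤c = subst (suc (suc a) ≤_) (sym c≡a+2+gap) (m≤m+n _ gap-above-a)
      G-a : G a ≡ true
      G-a = generator-below-2m (member-live (first-live z≤n)) (cell-positive 1 t₀ 0) (≤-trans (n≤1+n (suc a)) a+2≤m+m)
      G-a+1 : G (suc a) ≡ true
      G-a+1 = generator-below-2m (subst (λ z → member z ≡ true) (+-suc (1 * m + 2 + t₀ * s) 0)
                (member-live (first-live (s≤s z≤n)))) z<s a+2≤m+m
      below-m : Window (λ z → G z ≡ false) 0 m
      below-m r r<m = not-generator (<-≤-trans r<m m≤c) (<⇒≢ r<m) (<⇒≢ (<-≤-trans r<m m≤a))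
        (<⇒≢ (<-≤-trans r<m (≤-trans m≤a (n≤1+n a))))
      between-m-a : Window (λ z → G z ≡ false) (suc m) (suc (t₀ * s))
      between-m-a r r< = not-generator (<-≤-trans z<a (≤-trans (n≤1+n a) (≤-trans (n≤1+n (suc a)) a+2≤c)))
          (>⇒≢ (s≤s (m≤m+n m r))) (<⇒≢ z<a) (<⇒≢ (≤-trans z<a (n≤1+n a)))
        where
          z<a : suc m + r < a
          z<a = subst (suc m + r <_) hit-a (+-monoʳ-< (suc m) r<)
      above-a+1 : Window (λ z → G z ≡ false) (suc (suc a)) gap-above-a
      above-a+1 r r< = not-generator (subst (suc (suc a) + r <_) (sym c≡a+2+gap) (+-monoʳ-< (suc (suc a)) r<))
        (>⇒≢ (≤-trans (s≤s m≤a) a<z)) (>⇒≢ a<z) (>⇒≢ (s≤s (m≤m+n (suc a) r)))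
        where
          a<z : a < suc (suc a) + r
          a<z = s≤s (≤-trans (n≤1+n a) (m≤m+n (suc a) r))

  μ≤m : μ ≤ m
  μ≤m = m≤m+n μ u

  no-pattern-sum : ∀ {z} → z < (t + t) * m + μ → isPattern z ≡ false →
                   (∀ R → R ≤ t + 1 → z ≢ cell (t + t) t₀ (2 + R)) → ¬ PatternSum z
  no-pattern-sum _ off _ (inside p) = contradiction (trans (sym (InPattern⇒isPattern p)) off) λ ()
  no-pattern-sum _ _ not-corner (corner R R≤ eq) = not-corner R R≤ eq
  no-pattern-sum {z} z< _ _ (beyond far) =
    <⇒≱ (<-≤-trans z< (+-monoʳ-≤ ((t + t) * m) μ≤m)) (subst (_≤ z) (+-comm m ((t + t) * m)) far)

  generator-above-c : ∀ {z} → c ≤ z → z < (t + t) * m + μ → isPattern z ≡ false →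
                      (∀ R → R ≤ t + 1 → z ≢ cell (t + t) t₀ (2 + R)) → isMinGen S z ≡ true
  generator-above-c {z} c≤z z< off not-corner =
    isMinGen-indecomposable S (member-above c≤z) (<-≤-trans z<s (≤-trans (m≤n+m μ ((t + t₀) * m)) c≤z)) indecomposable
    where
      z<c+m : z < c + m
      z<c+m = subst (z <_) (sym (trans (cong (c +_) (+-comm μ u)) (trans (sym (+-assoc c u μ)) (cong (_+ μ) c+u≡2t*m))))
                z<
      too-big : ∀ {w y} → c ≤ w → 0 < y → member y ≡ true → w + y ≡ z → ⊥
      too-big {w} {y} c≤w 0<y hy w+y≡z =
        <⇒≱ (+-cancelˡ-< w y m (subst (_< w + m) (sym w+y≡z) (<-≤-trans z<c+m (+-monoˡ-≤ m c≤w))))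
        (proj₂ (proj₂ multiplicity) y 0<y hy)
      indecomposable : Indecomposable S z
      indecomposable {w} {y} 0<w 0<y w+y≡z hw hy with member-cases hw | member-cases hy
      ... | inj₁ c≤w | _         = too-big c≤w 0<y hy w+y≡z
      ... | inj₂ _   | inj₁ c≤y  = too-big c≤y 0<w hw (trans (+-comm y w) w+y≡z)
      ... | inj₂ pw  | inj₂ py   = no-pattern-sum z< off not-corner
        (subst PatternSum w+y≡z (pattern-+ (isPattern⇒InPattern w pw) (isPattern⇒InPattern y py)))

  cell-block-injective : ∀ k {e r e′ r′} → r < s → r′ < s → cell k e r ≡ cell k e′ r′ → e ≡ e′
  cell-block-injective k {e} {r} {e′} {r′} r<s r′<s eq = begin
    e                   ≡⟨ sym ([kn+r]/n≡k e r s r<s) ⟩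
    (e * s + r) / s     ≡⟨ cong (_/ s) (+-cancelˡ-≡ (k * m + 2) _ _
                             (trans (sym (+-assoc _ (e * s) r)) (trans eq (+-assoc _ (e′ * s) r′)))) ⟩
    (e′ * s + r′) / s   ≡⟨ [kn+r]/n≡k e′ r′ s r′<s ⟩
    e′                  ∎
    where open ≡-Reasoning

  generators-before-2t*m : Window (λ z → isMinGen S z ≡ true) c u
  generators-before-2t*m r r<u =
    generator-above-c (m≤m+n c r) (<-≤-trans z<2tm (m≤m+n _ μ)) (isPattern-above-conductor r r<u)
    λ R _ → <⇒≢ (<-≤-trans z<2tm (row-start (t + t) t₀ (2 + R)))
    where
      z<2tm : c + r < (t + t) * m
      z<2tm = subst (c + r <_) c+u≡2t*m (+-monoʳ-< c r<u)

  2t≡1+t+t₀ : t + t ≡ suc (t + t₀)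
  2t≡1+t+t₀ = +-suc t t₀

  non-generator-2t*m : isMinGen S ((t + t) * m) ≡ false
  non-generator-2t*m = subst (λ z → isMinGen S z ≡ false) (cong (_* m) (sym 2t≡1+t+t₀))
    (isMinGen-+ S m ((t + t₀) * m) z<s (<-≤-trans z<s (m≤m+n m ((t₀ + t₀) * m))) member-m (member-multiple (t + t₀)))

  generator-2t*m+1 : isMinGen S (suc ((t + t) * m)) ≡ true
  generator-2t*m+1 = generator-above-c (≤-trans c≤2t*m (n≤1+n _))
    (subst (_< (t + t) * m + μ) (+-comm ((t + t) * m) 1) (+-monoʳ-< ((t + t) * m) {1} {μ} (s≤s (s≤s z≤n))))
    (trans (cong isPattern (+-comm 1 ((t + t) * m))) (isPattern-gap (t + t)))
    λ R _ eq → contradiction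
      (+-cancelˡ-≡ ((t + t) * m) 1 _ (trans (+-comm _ 1) (trans eq (regroup ((t + t) * m) (t₀ * s) R)))) λ ()
    where
      regroup : ∀ a b R → a + 2 + b + (2 + R) ≡ a + (2 + b + (2 + R))
      regroup = solve-∀

  live-late-row : ∀ {e r} → e < t → r + e ≤ t → Live (t + t₀) e r
  live-late-row {e} e<t r+e≤t =
    mkLive e<t r+e≤t (≤-trans (≤-reflexive (trans 2t≡1+t+t₀ (+-comm 1 (t + t₀)))) (m≤m+n _ (e + e)))

  non-generator-low : ∀ {e r} → e < t → r + e ≤ t → isMinGen S (cell (t + t) e r) ≡ false
  non-generator-low {e} {r} e<t r+e≤t =
    subst (λ z → isMinGen S z ≡ false) (trans (cell-next-row (t + t₀) e r) (cong (λ k → cell k e r) (sym 2t≡1+t+t₀)))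
      (isMinGen-+ S m (cell (t + t₀) e r) z<s (cell-positive (t + t₀) e r) member-m
        (member-live (live-late-row e<t r+e≤t)))

  generator-tall : ∀ {e r} → e < t₀ → r < s → t < r + e → isMinGen S (cell (t + t) e r) ≡ true
  generator-tall {e} {r} e<t₀ r<s tall =
    generator-above-c (≤-trans c≤2t*m (row-start (t + t) e r)) z< off not-corner
    where
      e<t : e < t
      e<t = ≤-trans e<t₀ (n≤1+n t₀)
      z< : cell (t + t) e r < (t + t) * m + μ
      z< = subst (_< (t + t) * m + μ) (sym (cell-column (t + t) e r)) (+-monoʳ-< ((t + t) * m)
             (<-≤-trans (+-monoʳ-< 2 (column-bound e<t₀ r<s))
               (subst (2 + t₀ * s ≤_) (regroup t t₀ s) (m≤m+n (2 + t₀ * s) (4 + t)))))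
        where
          regroup : ∀ t t₀ s → 2 + t₀ * s + (4 + t) ≡ 6 + t + t₀ * s
          regroup = solve-∀
      off : isPattern (cell (t + t) e r) ≡ false
      off = trans (isPattern-cell (t + t) e<t r<s) (dec-false (live? (t + t) e r) (¬live-tall tall))
      corner<s : ∀ {R} → R ≤ t + 1 → 2 + R < s
      corner<s R≤ = ≤-<-trans (+-monoʳ-≤ 2 R≤) (subst (_< s) (trans (+-comm t 3) (cong (2 +_) (+-comm 1 t))) t+3<s)
      not-corner : ∀ R → R ≤ t + 1 → cell (t + t) e r ≢ cell (t + t) t₀ (2 + R)
      not-corner R R≤ eq = <-irrefl (cell-block-injective (t + t) r<s (corner<s R≤) eq) e<t₀

  corner-split : ∀ {r₁ r₂} → r₁ ≤ t → r₂ ≤ 1 → isMinGen S (cell (t + t) t₀ (2 + (r₁ + r₂))) ≡ false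
  corner-split {r₁} {r₂} r₁≤t r₂≤1 = subst (λ z → isMinGen S z ≡ false) sum≡
    (isMinGen-+ S (cell (t + t₀) 0 r₁) (cell 1 t₀ r₂) (cell-positive (t + t₀) 0 r₁) (cell-positive 1 t₀ r₂)
      (member-live (live-late-row z<s (subst (_≤ t) (sym (+-identityʳ r₁)) r₁≤t))) (member-live (first-live r₂≤1)))
    where
      regroup : ∀ a b c → a + 4 + b + c ≡ a + 2 + b + (2 + c)
      regroup = solve-∀
      sum≡ : cell (t + t₀) 0 r₁ + cell 1 t₀ r₂ ≡ cell (t + t) t₀ (2 + (r₁ + r₂))
      sum≡ = trans (cell-+ (t + t₀) 0 r₁ 1 t₀ r₂)
        (trans (cong (λ K → K * m + 4 + t₀ * s + (r₁ + r₂)) (sym (trans 2t≡1+t+t₀ (+-comm 1 (t + t₀)))))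
          (regroup ((t + t) * m) (t₀ * s) (r₁ + r₂)))

  non-generator-last-block : ∀ r → r < t + 4 → isMinGen S (cell (t + t) t₀ r) ≡ false
  non-generator-last-block zero          _ = non-generator-low ≤-refl (n≤1+n t₀)
  non-generator-last-block (suc zero)    _ = non-generator-low ≤-refl ≤-refl
  non-generator-last-block (suc (suc R)) r< with R ≤? t
  ... | yes R≤t = subst (λ x → isMinGen S (cell (t + t) t₀ (2 + x)) ≡ false) (+-identityʳ R) (corner-split R≤t z≤n)
  ... | no  R≰t = subst (λ x → isMinGen S (cell (t + t) t₀ (2 + x)) ≡ false) t+1≡R (corner-split ≤-refl ≤-refl)
    where
      t+4≡ : t + 4 ≡ 3 + suc t
      t+4≡ = +-comm t 4
      t+1≡R : t + 1 ≡ R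
      t+1≡R = trans (+-comm t 1)
        (≤-antisym (≰⇒> R≰t) (≤-pred (≤-pred (≤-pred (subst (suc (suc (suc R)) ≤_) t+4≡ r<)))))

  notGen : ℕ → Bool
  notGen z = not (isMinGen S z)

  block-D-count : ∀ n e → suc n + e ≡ t₀ → count notGen ((t + t) * m + 2 + e * s) s ≡ suc n + 2
  block-D-count n e n+e≡t₀ = trans (cong (count notGen base) (sym (m+[n∸m]≡n w≤s)))
    (count-prefix notGen base w (s ∸ w) low tall)
    where
      base = (t + t) * m + 2 + e * s
      w = suc n + 2
      e<t₀ : e < t₀
      e<t₀ = subst (e <_) n+e≡t₀ (s≤s (m≤n+m e n))
      w+e≡t+1 : w + e ≡ suc t
      w+e≡t+1 = trans (regroup n e) (cong (2 +_) n+e≡t₀)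
        where
          regroup : ∀ n e → suc n + 2 + e ≡ 2 + (suc n + e)
          regroup = solve-∀
      w≤s : w ≤ s
      w≤s = ≤-trans (m≤m+n w e) (subst (_≤ s) (sym w+e≡t+1) (<⇒≤ t+1<s))
        where
          t+1<s : suc t < s
          t+1<s = ≤-<-trans (subst (suc t ≤_) (+-comm 3 t) (≤-trans (n≤1+n (suc t)) (n≤1+n (suc (suc t))))) t+3<s
      low : Window (λ z → notGen z ≡ true) base w
      low r r<w = cong not (non-generator-low (≤-trans e<t₀ (n≤1+n t₀))
        (≤-pred (subst (suc r + e ≤_) w+e≡t+1 (+-monoˡ-≤ e r<w))))
      tall : Window (λ z → notGen z ≡ false) (base + w) (s ∸ w)
      tall r r< = trans (cong notGen (+-assoc base w r))
        (cong not (generator-tall e<t₀ (subst (w + r <_) (m+[n∸m]≡n w≤s) (+-monoʳ-< w r<))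
          (subst (_≤ w + r + e) w+e≡t+1 (+-monoˡ-≤ e (m≤m+n w r)))))

  blocks-D-count : ∀ n e → n + e ≡ t₀ → count notGen ((t + t) * m + 2 + e * s) (n * s) ≡ ladder n
  blocks-D-count zero    e _       = refl
  blocks-D-count (suc n) e n+e≡t₀ = begin
    count notGen ((t + t) * m + 2 + e * s) (s + n * s)
      ≡⟨ count-++ notGen ((t + t) * m + 2 + e * s) s (n * s) ⟩
    count notGen ((t + t) * m + 2 + e * s) s + count notGen ((t + t) * m + 2 + e * s + s) (n * s)
      ≡⟨ cong₂ _+_ (block-D-count n e n+e≡t₀) (cong (λ x → count notGen x (n * s)) (next-block ((t + t) * m) e s)) ⟩
    suc n + 2 + count notGen ((t + t) * m + 2 + suc e * s) (n * s)
      ≡⟨ cong (suc n + 2 +_) (blocks-D-count n (suc e) (trans (+-suc n e) n+e≡t₀)) ⟩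
    suc n + 2 + ladder n ∎
    where
      open ≡-Reasoning
      next-block : ∀ a e s → a + 2 + e * s + s ≡ a + 2 + suc e * s
      next-block = solve-∀

  count-D : count notGen c m ≡ suc (ladder t₀ + (t + 4))
  count-D = begin
    count notGen c m
      ≡⟨ cong (count notGen c) (+-comm μ u) ⟩
    count notGen c (u + μ)
      ≡⟨ count-++ notGen c u μ ⟩
    count notGen c u + count notGen (c + u) μ
      ≡⟨ cong₂ _+_ (count-none notGen c u λ r r<u → cong not (generators-before-2t*m r r<u))
                   (cong (λ x → count notGen x μ) c+u≡2t*m) ⟩
    count notGen ((t + t) * m) μ
      ≡⟨ cong (count notGen ((t + t) * m)) μ≡ ⟩
    count notGen ((t + t) * m) (2 + (t₀ * s + (t + 4)))
      ≡⟨ cong₂ (λ x y → (if x then 1 else 0) + ((if y then 1 else 0) + rest))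
           (cong not non-generator-2t*m) (cong not generator-2t*m+1) ⟩
    1 + count notGen (2 + (t + t) * m) (t₀ * s + (t + 4))
      ≡⟨ cong suc (count-++ notGen _ (t₀ * s) (t + 4)) ⟩
    1 + (count notGen (2 + (t + t) * m) (t₀ * s) + count notGen (2 + (t + t) * m + t₀ * s) (t + 4))
      ≡⟨ cong suc (cong₂ _+_
           (trans (cong (λ x → count notGen x (t₀ * s)) (first-block ((t + t) * m) s))
             (blocks-D-count t₀ 0 (+-identityʳ t₀)))
           (trans (cong (λ x → count notGen (x + t₀ * s) (t + 4)) (+-comm 2 ((t + t) * m)))
             (count-all notGen ((t + t) * m + 2 + t₀ * s) (t + 4)
               λ r r< → cong not (non-generator-last-block r r<)))) ⟩
    suc (ladder t₀ + (t + 4)) ∎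
    where
      open ≡-Reasoning
      μ≡ : μ ≡ 2 + (t₀ * s + (t + 4))
      μ≡ = regroup t₀ (t₀ * s)
        where
          regroup : ∀ t₀ X → 6 + suc t₀ + X ≡ 2 + (X + (suc t₀ + 4))
          regroup = solve-∀
      first-block : ∀ a s → 2 + a ≡ a + 2 + 0 * s
      first-block = solve-∀
      rest = count notGen (2 + (t + t) * m) (t₀ * s + (t + 4))

  -- ceilDiv c m unfolds to (c + (m − 1)) / m.
  q≡2t : ceilDiv c m ≡ t + t
  q≡2t = trans (cong (_/ m) c+m-1≡) ([kn+r]/n≡k (t + t) (5 + t + t₀ * s) m (m≤m+n (6 + t + t₀ * s) u))
    where
      regroup : ∀ c X u → c + (X + u) ≡ c + u + X
      regroup = solve-∀
      c+m-1≡ : c + (5 + t + t₀ * s + u) ≡ (t + t) * m + (5 + t + t₀ * s)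
      c+m-1≡ = trans (regroup c (5 + t + t₀ * s) u) (cong (_+ (5 + t + t₀ * s)) c+u≡2t*m)

  ρ≡u : ceilDiv c m * m ∸ c ≡ u
  ρ≡u = trans (cong (λ q → q * m ∸ c) q≡2t) (trans (cong (_∸ c) (sym c+u≡2t*m)) (m+n∸m≡n c u))

  3L+triangle≡2tD : 3 * count member 0 c + triangle t ≡ (t + t) * count notGen c m
  3L+triangle≡2tD = begin
    3 * count member 0 c + triangle t                            ≡⟨ cong (λ x → 3 * x + triangle t) count-L ⟩
    3 * (t + t + sumBelow (t + t) (rowLit t)) + triangle t       ≡⟨ staircase-balance t₀ ⟩
    (t + t) * suc (ladder t₀ + (t + 4))                          ≡⟨ cong ((t + t) *_) (sym count-D) ⟩
    (t + t) * count notGen c m                                   ∎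
    where open ≡-Reasoning

  eliahou≡u⊖triangle : eliahou S c m ≡ u ⊖ triangle t
  eliahou≡u⊖triangle = begin
    eliahou S c m
      ≡⟨ cong₂ (λ x y → (ℤ.+ (x * L) ℤ.- ℤ.+ y) ℤ.+ ℤ.+ (ceilDiv c m * m ∸ c))
           count-generators-L (cong (_* count notGen c m) q≡2t) ⟩
    (ℤ.+ (3 * L) ℤ.- ℤ.+ ((t + t) * count notGen c m)) ℤ.+ ℤ.+ (ceilDiv c m * m ∸ c)
      ≡⟨ cong₂ (λ y z → (ℤ.+ (3 * L) ℤ.- ℤ.+ y) ℤ.+ ℤ.+ z) (sym 3L+triangle≡2tD) ρ≡u ⟩
    (ℤ.+ (3 * L) ℤ.- ℤ.+ (3 * L + triangle t)) ℤ.+ ℤ.+ u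
      ≡⟨ cong (ℤ._+ ℤ.+ u) (trans ([+m]-[+n]≡m⊖n (3 * L) (3 * L + triangle t))
             (trans (cong (_⊖ (3 * L + triangle t)) (sym (+-identityʳ (3 * L))))
               (+-cancelˡ-⊖ (3 * L) 0 (triangle t)))) ⟩
    (0 ⊖ triangle t) ℤ.+ ℤ.+ u
      ≡⟨ distribˡ-⊖-+-pos u 0 (triangle t) ⟩
    u ⊖ triangle t ∎
    where
      open ≡-Reasoning
      L = count member 0 c

every-integer-is-u⊖triangle : ∀ n → ∃[ t₀ ] ∃[ u ] u ⊖ triangle (suc t₀) ≡ n
every-integer-is-u⊖triangle (ℤ.+ k)    = 0 , k , refl
every-integer-is-u⊖triangle ℤ.-[1+ k ] = suc k , triangle (suc k) ,
  trans (cong₂ _⊖_ (sym (+-identityʳ (triangle (suc k)))) (+-comm (suc k) (triangle (suc k))))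
        (+-cancelˡ-⊖ (triangle (suc k)) 0 (suc k))

corollary4p8 : (n : ℤ) → ∃[ S ] ∃[ c ] ∃[ m ]
    (IsConductor S c × IsMultiplicity S m × eliahou S c m ≡ n)
corollary4p8 n with every-integer-is-u⊖triangle n
... | t₀ , u , u⊖triangle≡n = S , c , m , conductor , multiplicity , trans eliahou≡u⊖triangle u⊖triangle≡n
  where open Staircase t₀ u
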